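{- Let $N$ be a positive integer and let $A\subseteq\mathbb{Z}/N\mathbb{Z}$ be a set of size $n$. Assume that $|(A-A)\setminus[b,b+l]|<n/2$ for some $b\in\mathbb{Z}/N\mathbb{Z}$ and some integer $l<N/3$. Then $A\subseteq[a,a+l]$ for some $a\in\mathbb{Z}/N\mathbb{Z}$.
   Context: For $c\in\mathbb{Z}/N\mathbb{Z}$ and a nonnegative integer $l$, $[c,c+l]$ denotes $\{c,c+1,\dots,c+l\}\subseteq\mathbb{Z}/N\mathbb{Z}$. $A-A=\{a-a':a,a'\in A\}$. -}

module Defs where

open import Data.Nat using (ℕ; zero; suc; _+_; _∸_; _≤_; _≤?_; NonZero)
open import Data.Nat.DivMod using (_%_)
open import Data.Fin using (Fin; toℕ; fromℕ<)
open import Data.Fin.Subset using (Subset; _∈_; _∩_; ∁; inside; outside)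
open import Data.Fin.Subset.Properties using (_∈?_)
open import Data.Fin.Properties using (any?)
open import Data.Product using (_×_; _,_)
open import Data.Vec using (tabulate)
open import Relation.Nullary using (Dec; yes; no)
open import Relation.Nullary.Decidable using (_×-dec_)
open import Relation.Binary.PropositionalEquality using (_≡_)
open import Data.Fin.Properties using (_≟_)
open import Data.Nat.DivMod using (m%n<n)

-- ℤ/Nℤ is modelled as Fin N (residues 0..N-1), N ≥ 1.
module _ {N : ℕ} .{{_ : NonZero N}} where

  _⊖_ : Fin N → Fin N → Fin N
  x ⊖ y = fromℕ< (m%n<n (toℕ x + (N ∸ toℕ y)) N)

  interval : Fin N → ℕ → Subset N
  interval c l = tabulate λ x → Data.Bool.if does (toℕ (x ⊖ c) ≤? l) then inside else outside
    where open import Relation.Nullary using (does)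
          import Data.Bool

  diffSet : Subset N → Subset N
  diffSet A = tabulate λ d →
    Data.Bool.if does (any? λ a → any? λ a' → (a ∈? A) ×-dec ((a' ∈? A) ×-dec (d ≟ (a ⊖ a'))))
      then inside else outside
    where open import Relation.Nullary using (does)
          import Data.Bool

{-# OPTIONS --safe #-}
-- Let I = [b, b+l] and D = (A − A) ∖ I. For z ∈ A, the map a ↦ z − a injects {a ∈ A : z − a ∉ I}
-- into D, so fewer than n/2 elements of A are bad for z. Hence any x, y ∈ A have a common a ∈ A
-- with x − a, y − a ∈ I, which puts x − y in I − I = [−l, l].
-- Because 3l < N such a set cannot wrap around ℤ/Nℤ: measured from a₀ − l for some a₀ ∈ A, its
-- elements have representatives in [0, 2l], whose pairwise differences are then at most l as
-- integers, so A lies in [m, m + l] for the element m of smallest representative.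
module Submission where

open import Defs
open import Data.Nat using (ℕ; _*_; _<_; NonZero)
open import Data.Fin using (Fin)
open import Data.Fin.Subset using (Subset; ∣_∣; _∩_; ∁; _⊆_)
open import Data.Product using (∃)

open import Algebra.Properties.CommutativeSemigroup using (x∙yz≈y∙xz; xy∙z≈xz∙y; xy∙z≈zy∙x)
open import Data.Bool.Base using (if_then_else_)
open import Data.Fin using (toℕ; fromℕ<)
import Data.Fin as Fin
open import Data.Fin.Properties using (_≟_; toℕ-fromℕ<; toℕ-injective; toℕ<n; suc-injective; 0≢1+n; any?)
open import Data.Fin.Subset using (_∈_; _∪_; _-_; inside; outside; Nonempty)
open import Data.Fin.Subset.Properties
  using (_∈?_; nonempty?; Empty-unique; ∣⊥∣≡0; p⊆q⇒∣p∣≤∣q∣; x∈p⇒∣p-x∣<∣p∣; x∈p∧x≢y⇒x∈p-y;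
         x∈p∩q⁺; x∉p⇒x∈∁p; x∈p∪q⁺)
open import Data.List.Base using (List; filter; allFin)
open import Data.List.Membership.Propositional.Properties using (∈-filter⁺; ∈-allFin)
import Data.List.Relation.Unary.All as All
open import Data.List.Relation.Unary.All.Properties using (all-filter)
open import Data.Nat using (zero; suc; _+_; _∸_; _≤_; _≤?_; z≤n; s≤s)
open import Data.Nat.DivMod using (_%_; _/_; m≡m%n+[m/n]*n)
open import Data.Nat.Properties
  using (+-assoc; +-comm; +-identityʳ; +-suc; *-identityˡ; *-distribʳ-+; +-commutativeSemigroup;
         +-cancelˡ-≡; +-cancelˡ-≤; m∸n+n≡m; m≤m+n; m≤n+m; n≤1+n; <⇒≤; <⇒≱; >⇒≢; ≤-trans; ≤-<-trans;
         <-≤-trans; +-mono-≤; +-monoʳ-≤; +-mono-<-≤; +-mono-≤-<; ≤-totalOrder; module ≤-Reasoning)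
open import Data.Product using (∃₂; _×_; _,_)
open import Data.Sum using (inj₁; inj₂)
open import Data.Vec using (_∷_; []; tabulate; here; there)
open import Data.Vec.Properties using (lookup∘tabulate; []=⇒lookup; lookup⇒[]=)
open import Function.Base using (_∘_)
open import Function.Definitions using (Injective)
open import Relation.Binary.Bundles using (Setoid)
open import Relation.Binary.PropositionalEquality
open import Relation.Nullary using (yes; no; does; ¬_; ¬?; contradiction)
open import Relation.Nullary.Decidable using (_×-dec_; dec-true)
open import Relation.Unary using (Decidable)
import Data.List.Extrema
import Relation.Binary.Reasoning.Setoid

-- Congruence of naturals written without subtraction, so that ℕ-arithmetic applies directly.
infix 4 _≡_mod_
_≡_mod_ : ℕ → ℕ → ℕ → Set
_≡_mod_ p q N = ∃₂ λ k j → p + k * N ≡ q + j * N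

module _ {N : ℕ} where

  ≡mod-setoid : Setoid _ _
  ≡mod-setoid = record
    { Carrier       = ℕ
    ; _≈_           = _≡_mod N
    ; isEquivalence = record { refl = 0 , 0 , refl ; sym = sym′ ; trans = trans′ }
    }
    where
    sym′ : ∀ {p q} → p ≡ q mod N → q ≡ p mod N
    sym′ (k , j , eq) = j , k , sym eq
    trans′ : ∀ {p q r} → p ≡ q mod N → q ≡ r mod N → p ≡ r mod N
    trans′ {p} {q} {r} (k , j , p≡q) (k′ , j′ , q≡r) = k + k′ , j′ + j , (begin
      p + (k + k′) * N        ≡⟨ cong (p +_) (*-distribʳ-+ N k k′) ⟩
      p + (k * N + k′ * N)    ≡⟨ +-assoc p _ _ ⟨
      p + k * N + k′ * N      ≡⟨ cong (_+ k′ * N) p≡q ⟩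
      q + j * N + k′ * N      ≡⟨ xy∙z≈xz∙y +-commutativeSemigroup q _ _ ⟩
      q + k′ * N + j * N      ≡⟨ cong (_+ j * N) q≡r ⟩
      r + j′ * N + j * N      ≡⟨ +-assoc r _ _ ⟩
      r + (j′ * N + j * N)    ≡⟨ cong (r +_) (*-distribʳ-+ N j′ j) ⟨
      r + (j′ + j) * N        ∎)
      where open ≡-Reasoning

  +-congˡ-mod : ∀ r {p q} → p ≡ q mod N → r + p ≡ r + q mod N
  +-congˡ-mod r {p} {q} (k , j , eq) = k , j , (begin
    r + p + k * N    ≡⟨ +-assoc r p _ ⟩
    r + (p + k * N)  ≡⟨ cong (r +_) eq ⟩
    r + (q + j * N)  ≡⟨ +-assoc r q _ ⟨
    r + q + j * N    ∎)
    where open ≡-Reasoning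

  +-cancelˡ-mod : ∀ r {p q} → r + p ≡ r + q mod N → p ≡ q mod N
  +-cancelˡ-mod r {p} {q} (k , j , eq) = k , j , +-cancelˡ-≡ r _ _ (begin
    r + (p + k * N)  ≡⟨ +-assoc r p _ ⟨
    r + p + k * N    ≡⟨ eq ⟩
    r + q + j * N    ≡⟨ +-assoc r q _ ⟩
    r + (q + j * N)  ∎)
    where open ≡-Reasoning

  +-congʳ-mod : ∀ r {p q} → p ≡ q mod N → p + r ≡ q + r mod N
  +-congʳ-mod r {p} {q} rewrite +-comm p r | +-comm q r = +-congˡ-mod r

  +-cancelʳ-mod : ∀ r {p q} → p + r ≡ q + r mod N → p ≡ q mod N
  +-cancelʳ-mod r {p} {q} rewrite +-comm p r | +-comm q r = +-cancelˡ-mod r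

  m%N≡m-mod : ∀ m .{{_ : NonZero N}} → m % N ≡ m mod N
  m%N≡m-mod m = m / N , 0 , trans (sym (m≡m%n+[m/n]*n m N)) (sym (+-identityʳ m))

  m+N≡m-mod : ∀ m → m + N ≡ m mod N
  m+N≡m-mod m = 0 , 1 , trans (+-identityʳ _) (cong (m +_) (sym (*-identityˡ N)))

  private
    q+N≤p : ∀ {p q j} → p + 0 * N ≡ q + suc j * N → q + N ≤ p
    q+N≤p {p} {q} {j} eq = begin
      q + N            ≤⟨ m≤m+n _ _ ⟩
      q + N + j * N    ≡⟨ +-assoc q N _ ⟩
      q + suc j * N    ≡⟨ eq ⟨
      p + 0            ≡⟨ +-identityʳ p ⟩
      p                ∎
      where open ≤-Reasoning

  ≡mod⇒≡ : ∀ {p q} → p ≡ q mod N → p < q + N → q < p + N → p ≡ q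
  ≡mod⇒≡ {p} {q} (k , j , eq) = go k j eq
    where
    go : ∀ k j → p + k * N ≡ q + j * N → p < q + N → q < p + N → p ≡ q
    go zero    zero    eq _     _     = trans (sym (+-identityʳ p)) (trans eq (+-identityʳ q))
    go zero    (suc j) eq p<q+N _     = contradiction (q+N≤p {j = j} eq) (<⇒≱ p<q+N)
    go (suc k) zero    eq _     q<p+N = contradiction (q+N≤p {j = k} (sym eq)) (<⇒≱ q<p+N)
    go (suc k) (suc j) eq             = go k j (+-cancelˡ-≡ N _ _ (begin
      N + (p + k * N)  ≡⟨ x∙yz≈y∙xz +-commutativeSemigroup N p _ ⟩
      p + (N + k * N)  ≡⟨ eq ⟩
      q + (N + j * N)  ≡⟨ x∙yz≈y∙xz +-commutativeSemigroup q N _ ⟩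
      N + (q + j * N)  ∎))
      where open ≡-Reasoning

  ≡mod∧<N⇒≡ : ∀ {p q} → p ≡ q mod N → p < N → q < N → p ≡ q
  ≡mod∧<N⇒≡ {p} {q} eq p<N q<N = ≡mod⇒≡ eq (<-≤-trans p<N (m≤n+m N q)) (<-≤-trans q<N (m≤n+m N p))

module ≡mod-Reasoning (N : ℕ) = Relation.Binary.Reasoning.Setoid (≡mod-setoid {N})

module _ {n : ℕ} {P : Fin n → Set} (P? : Decidable P) where

  select : Subset n
  select = tabulate λ x → if does (P? x) then inside else outside

  ∈-select⁺ : ∀ {x} → P x → x ∈ select
  ∈-select⁺ {x} px = lookup⇒[]= x select
    (trans (lookup∘tabulate _ x) (cong (if_then inside else outside) (dec-true (P? x) px)))

  ∈-select⁻ : ∀ {x} → x ∈ select → P x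
  ∈-select⁻ {x} x∈ with P? x | trans (sym (lookup∘tabulate _ x)) ([]=⇒lookup x∈)
  ... | yes px | _  = px
  ... | no _   | ()

∣p∪q∣≤∣p∣+∣q∣ : ∀ {n} (p q : Subset n) → ∣ p ∪ q ∣ ≤ ∣ p ∣ + ∣ q ∣
∣p∪q∣≤∣p∣+∣q∣ []            []            = z≤n
∣p∪q∣≤∣p∣+∣q∣ (outside ∷ p) (outside ∷ q) = ∣p∪q∣≤∣p∣+∣q∣ p q
∣p∪q∣≤∣p∣+∣q∣ (outside ∷ p) (inside  ∷ q) =
  subst (suc ∣ p ∪ q ∣ ≤_) (sym (+-suc ∣ p ∣ ∣ q ∣)) (s≤s (∣p∪q∣≤∣p∣+∣q∣ p q))
∣p∪q∣≤∣p∣+∣q∣ (inside  ∷ p) (outside ∷ q) = s≤s (∣p∪q∣≤∣p∣+∣q∣ p q)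
∣p∪q∣≤∣p∣+∣q∣ (inside  ∷ p) (inside  ∷ q) =
  s≤s (≤-trans (∣p∪q∣≤∣p∣+∣q∣ p q) (+-monoʳ-≤ ∣ p ∣ (n≤1+n ∣ q ∣)))

injective⇒∣p∣≤∣q∣ : ∀ {m n} {p : Subset m} {q : Subset n} (f : Fin m → Fin n) →
  Injective _≡_ _≡_ f → (∀ {x} → x ∈ p → f x ∈ q) → ∣ p ∣ ≤ ∣ q ∣
injective⇒∣p∣≤∣q∣ {p = []} f _ _ = z≤n
injective⇒∣p∣≤∣q∣ {p = outside ∷ p} f f-inj f[p]⊆q =
  injective⇒∣p∣≤∣q∣ (f ∘ Fin.suc) (suc-injective ∘ f-inj) (f[p]⊆q ∘ there)
injective⇒∣p∣≤∣q∣ {p = inside ∷ p} {q} f f-inj f[p]⊆q = ≤-<-trans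
  (injective⇒∣p∣≤∣q∣ {q = q - f Fin.zero} (f ∘ Fin.suc) (suc-injective ∘ f-inj)
    (λ x∈p → x∈p∧x≢y⇒x∈p-y (f[p]⊆q (there x∈p)) (0≢1+n ∘ f-inj ∘ sym)))
  (x∈p⇒∣p-x∣<∣p∣ (f[p]⊆q here))

0<∣p∣⇒Nonempty : ∀ {n} {p : Subset n} → 0 < ∣ p ∣ → Nonempty p
0<∣p∣⇒Nonempty {n} {p} 0<∣p∣ with nonempty? p
... | yes p≢∅ = p≢∅
... | no  p≡∅ = contradiction (trans (cong ∣_∣ (Empty-unique p≡∅)) (∣⊥∣≡0 n)) (>⇒≢ 0<∣p∣)

module _ {N : ℕ} .{{_ : NonZero N}} where

  x⊖y+y≡x : ∀ x y → toℕ (x ⊖ y) + toℕ y ≡ toℕ x mod N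
  x⊖y+y≡x x y = begin
    toℕ (x ⊖ y) + toℕ y                ≡⟨ cong (_+ toℕ y) (toℕ-fromℕ< _) ⟩
    (toℕ x + (N ∸ toℕ y)) % N + toℕ y  ≈⟨ +-congʳ-mod (toℕ y) (m%N≡m-mod _) ⟩
    toℕ x + (N ∸ toℕ y) + toℕ y        ≡⟨ +-assoc (toℕ x) _ _ ⟩
    toℕ x + (N ∸ toℕ y + toℕ y)        ≡⟨ cong (toℕ x +_) (m∸n+n≡m (<⇒≤ (toℕ<n y))) ⟩
    toℕ x + N                          ≈⟨ m+N≡m-mod (toℕ x) ⟩
    toℕ x                              ∎
    where open ≡mod-Reasoning N

  ⊖-cancelˡ-≡ : ∀ z → Injective _≡_ _≡_ (z ⊖_)
  ⊖-cancelˡ-≡ z {x} {y} z⊖x≡z⊖y = toℕ-injective (≡mod∧<N⇒≡ x≡y (toℕ<n x) (toℕ<n y))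
    where
    x≡y : toℕ x ≡ toℕ y mod N
    x≡y = +-cancelˡ-mod (toℕ (z ⊖ x)) (begin
      toℕ (z ⊖ x) + toℕ x  ≈⟨ x⊖y+y≡x z x ⟩
      toℕ z                ≈⟨ x⊖y+y≡x z y ⟨
      toℕ (z ⊖ y) + toℕ y  ≡⟨ cong (λ w → toℕ w + toℕ y) z⊖x≡z⊖y ⟨
      toℕ (z ⊖ x) + toℕ y  ∎)
      where open ≡mod-Reasoning N

  ∈-interval⁺ : ∀ {c l x} → toℕ (x ⊖ c) ≤ l → x ∈ interval c l
  ∈-interval⁺ {c} {l} = ∈-select⁺ (λ x → toℕ (x ⊖ c) ≤? l)

  ∈-interval⁻ : ∀ {c l x} → x ∈ interval c l → toℕ (x ⊖ c) ≤ l
  ∈-interval⁻ {c} {l} = ∈-select⁻ (λ x → toℕ (x ⊖ c) ≤? l)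

  ∈-diffSet⁺ : ∀ {A x y} → x ∈ A → y ∈ A → x ⊖ y ∈ diffSet A
  ∈-diffSet⁺ {A} {x} {y} x∈A y∈A =
    ∈-select⁺ (λ d → any? λ a → any? λ a′ → (a ∈? A) ×-dec ((a′ ∈? A) ×-dec (d ≟ (a ⊖ a′))))
      (x , y , x∈A , y∈A , refl)

  -- x − y ∈ [−l, l], i.e. x − y = u − v for some u, v ∈ [0, l]
  DifferencesWithin : ℕ → Subset N → Set
  DifferencesWithin l A = ∀ {x y} → x ∈ A → y ∈ A →
    ∃₂ λ u v → u ≤ l × v ≤ l × toℕ x + v ≡ toℕ y + u mod N

  module Unwrap {A : Subset N} {l : ℕ} (3l<N : 3 * l < N) (close : DifferencesWithin l A)
                {a₀ : Fin N} (a₀∈A : a₀ ∈ A) where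

    private
      3l<N′ : l + l + l < N
      3l<N′ = subst (_< N) (trans (cong (λ t → l + (l + t)) (+-identityʳ l)) (sym (+-assoc l l l)))
                3l<N

      2l<N : l + l < N
      2l<N = ≤-<-trans (m≤m+n (l + l) l) 3l<N′

      l<N : l < N
      l<N = ≤-<-trans (m≤m+n l l) 2l<N

    c : Fin N
    c = a₀ ⊖ fromℕ< l<N

    depth : Fin N → ℕ
    depth x = toℕ (x ⊖ c)

    depth-cong : ∀ {x y u v} → toℕ x + v ≡ toℕ y + u mod N → depth x + v ≡ depth y + u mod N
    depth-cong {x} {y} {u} {v} x+v≡y+u = +-cancelʳ-mod (toℕ c) (begin
      depth x + v + toℕ c  ≡⟨ xy∙z≈xz∙y +-commutativeSemigroup (depth x) v _ ⟩
      depth x + toℕ c + v  ≈⟨ +-congʳ-mod v (x⊖y+y≡x x c) ⟩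
      toℕ x + v            ≈⟨ x+v≡y+u ⟩
      toℕ y + u            ≈⟨ +-congʳ-mod u (x⊖y+y≡x y c) ⟨
      depth y + toℕ c + u  ≡⟨ xy∙z≈xz∙y +-commutativeSemigroup (depth y) _ u ⟩
      depth y + u + toℕ c  ∎)
      where open ≡mod-Reasoning N

    depth[a₀]≡l : depth a₀ ≡ l
    depth[a₀]≡l = ≡mod∧<N⇒≡ (+-cancelʳ-mod (toℕ c) (begin
      depth a₀ + toℕ c           ≈⟨ x⊖y+y≡x a₀ c ⟩
      toℕ a₀                     ≈⟨ x⊖y+y≡x a₀ (fromℕ< l<N) ⟨
      toℕ c + toℕ (fromℕ< l<N)   ≡⟨ cong (toℕ c +_) (toℕ-fromℕ< l<N) ⟩
      toℕ c + l                  ≡⟨ +-comm (toℕ c) l ⟩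
      l + toℕ c                  ∎)) (toℕ<n _) l<N
      where open ≡mod-Reasoning N

    depth≤2l : ∀ {x} → x ∈ A → depth x ≤ l + l
    depth≤2l {x} x∈A with close x∈A a₀∈A
    ... | u , v , u≤l , v≤l , x+v≡a₀+u = begin
      depth x      ≤⟨ m≤m+n (depth x) v ⟩
      depth x + v  ≡⟨ ≡mod⇒≡ x≡a₀ below above ⟩
      l + u        ≤⟨ +-monoʳ-≤ l u≤l ⟩
      l + l        ∎
      where
      open ≤-Reasoning
      x≡a₀ : depth x + v ≡ l + u mod N
      x≡a₀ = subst (λ d → depth x + v ≡ d + u mod N) depth[a₀]≡l (depth-cong x+v≡a₀+u)
      below : depth x + v < l + u + N
      below = subst (depth x + v <_) (+-comm N (l + u))
                (+-mono-<-≤ (toℕ<n (x ⊖ c)) (≤-trans v≤l (m≤m+n l u)))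
      above : l + u < depth x + v + N
      above = <-≤-trans (≤-<-trans (+-monoʳ-≤ l u≤l) 2l<N) (m≤n+m N _)

    depth+≤l<N : ∀ {x w} → x ∈ A → w ≤ l → depth x + w < N
    depth+≤l<N x∈A w≤l = ≤-<-trans (+-mono-≤ (depth≤2l x∈A) w≤l) 3l<N′

    depth-close : ∀ {x y} → x ∈ A → y ∈ A → depth x ≤ depth y + l
    depth-close {x} {y} x∈A y∈A with close x∈A y∈A
    ... | u , v , u≤l , v≤l , x+v≡y+u = begin
      depth x      ≤⟨ m≤m+n (depth x) v ⟩
      depth x + v  ≡⟨ ≡mod∧<N⇒≡ (depth-cong x+v≡y+u) (depth+≤l<N x∈A v≤l) (depth+≤l<N y∈A u≤l) ⟩
      depth y + u  ≤⟨ +-monoʳ-≤ (depth y) u≤l ⟩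
      depth y + l  ∎
      where open ≤-Reasoning

    open Data.List.Extrema ≤-totalOrder using (argmin; argmin-all; f[argmin]≤f[xs])

    elements : List (Fin N)
    elements = filter (_∈? A) (allFin N)

    lowest : Fin N
    lowest = argmin depth a₀ elements

    lowest∈A : lowest ∈ A
    lowest∈A = argmin-all depth a₀∈A (all-filter (_∈? A) (allFin N))

    lowest-minimal : ∀ {x} → x ∈ A → depth lowest ≤ depth x
    lowest-minimal {x} x∈A =
      All.lookup (f[argmin]≤f[xs] {f = depth} a₀ elements) (∈-filter⁺ (_∈? A) (∈-allFin x) x∈A)

    A⊆interval[lowest] : A ⊆ interval lowest l
    A⊆interval[lowest] {x} x∈A = ∈-interval⁺ {c = lowest} (+-cancelˡ-≤ (depth lowest) w l
      (subst (_≤ depth lowest + l) (sym lowest+w≡x) (depth-close x∈A lowest∈A)))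
      where
      open ≡mod-Reasoning N
      w : ℕ
      w = toℕ (x ⊖ lowest)
      lowest+w≡x+0 : toℕ lowest + w ≡ toℕ x + 0 mod N
      lowest+w≡x+0 = begin
        toℕ lowest + w  ≡⟨ +-comm (toℕ lowest) w ⟩
        w + toℕ lowest  ≈⟨ x⊖y+y≡x x lowest ⟩
        toℕ x           ≡⟨ +-identityʳ (toℕ x) ⟨
        toℕ x + 0       ∎
      below : depth lowest + w < depth x + 0 + N
      below = subst (depth lowest + w <_) (cong (_+ N) (sym (+-identityʳ (depth x))))
                (+-mono-≤-< (lowest-minimal x∈A) (toℕ<n (x ⊖ lowest)))
      above : depth x + 0 < depth lowest + w + N
      above = <-≤-trans (subst (_< N) (sym (+-identityʳ (depth x))) (toℕ<n (x ⊖ c))) (m≤n+m N _)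
      lowest+w≡x : depth lowest + w ≡ depth x
      lowest+w≡x = trans (≡mod⇒≡ (depth-cong lowest+w≡x+0) below above) (+-identityʳ (depth x))

  differencesWithin⇒⊆interval : ∀ {A l} → 3 * l < N → DifferencesWithin l A → Nonempty A →
                                ∃ λ a → A ⊆ interval a l
  differencesWithin⇒⊆interval 3l<N close (a₀ , a₀∈A) = lowest , A⊆interval[lowest]
    where open Unwrap 3l<N close a₀∈A

  module CommonBases {A : Subset N} {b : Fin N} {l : ℕ}
                     (few : 2 * ∣ diffSet A ∩ ∁ (interval b l) ∣ < ∣ A ∣) where

    I : Subset N
    I = interval b l

    D : Subset N
    D = diffSet A ∩ ∁ I

    Far : Fin N → Fin N → Set
    Far z a = a ∈ A × ¬ (z ⊖ a ∈ I)

    far? : ∀ z → Decidable (Far z)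
    far? z a = (a ∈? A) ×-dec ¬? ((z ⊖ a) ∈? I)

    far : Fin N → Subset N
    far z = select (far? z)

    ∣far∣≤∣D∣ : ∀ {z} → z ∈ A → ∣ far z ∣ ≤ ∣ D ∣
    ∣far∣≤∣D∣ {z} z∈A = injective⇒∣p∣≤∣q∣ (z ⊖_) (⊖-cancelˡ-≡ z) λ a∈far →
      let (a∈A , z⊖a∉I) = ∈-select⁻ (far? z) a∈far
      in  x∈p∩q⁺ (∈-diffSet⁺ z∈A a∈A , x∉p⇒x∈∁p z⊖a∉I)

    commonBase : ∀ {x y} → x ∈ A → y ∈ A → ∃ λ a → a ∈ A × x ⊖ a ∈ I × y ⊖ a ∈ I
    commonBase {x} {y} x∈A y∈A with any? (λ a → (a ∈? A) ×-dec ((x ⊖ a) ∈? I) ×-dec ((y ⊖ a) ∈? I))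
    ... | yes base = base
    ... | no  none = contradiction ∣A∣≤2∣D∣ (<⇒≱ few)
      where
      A⊆far∪far : A ⊆ far x ∪ far y
      A⊆far∪far {a} a∈A with (x ⊖ a) ∈? I | (y ⊖ a) ∈? I
      ... | no  x⊖a∉I | _           = x∈p∪q⁺ (inj₁ (∈-select⁺ (far? x) (a∈A , x⊖a∉I)))
      ... | yes _     | no  y⊖a∉I   = x∈p∪q⁺ (inj₂ (∈-select⁺ (far? y) (a∈A , y⊖a∉I)))
      ... | yes x⊖a∈I | yes y⊖a∈I   = contradiction (a , a∈A , x⊖a∈I , y⊖a∈I) none
      ∣A∣≤2∣D∣ : ∣ A ∣ ≤ 2 * ∣ D ∣
      ∣A∣≤2∣D∣ = begin
        ∣ A ∣                    ≤⟨ p⊆q⇒∣p∣≤∣q∣ A⊆far∪far ⟩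
        ∣ far x ∪ far y ∣        ≤⟨ ∣p∪q∣≤∣p∣+∣q∣ (far x) (far y) ⟩
        ∣ far x ∣ + ∣ far y ∣    ≤⟨ +-mono-≤ (∣far∣≤∣D∣ x∈A) (∣far∣≤∣D∣ y∈A) ⟩
        ∣ D ∣ + ∣ D ∣            ≡⟨ cong (∣ D ∣ +_) (+-identityʳ ∣ D ∣) ⟨
        2 * ∣ D ∣                ∎
        where open ≤-Reasoning

    differencesWithin : DifferencesWithin l A
    differencesWithin {x} {y} x∈A y∈A with commonBase x∈A y∈A
    ... | a , _ , x⊖a∈I , y⊖a∈I =
      u , v , ∈-interval⁻ {c = b} x⊖a∈I , ∈-interval⁻ {c = b} y⊖a∈I , (begin
        toℕ x + v      ≈⟨ +-congʳ-mod v (viaBase x) ⟨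
        u + a+b + v    ≡⟨ xy∙z≈zy∙x +-commutativeSemigroup u a+b v ⟩
        v + a+b + u    ≈⟨ +-congʳ-mod u (viaBase y) ⟩
        toℕ y + u      ∎)
      where
      open ≡mod-Reasoning N
      u v a+b : ℕ
      u = toℕ ((x ⊖ a) ⊖ b)
      v = toℕ ((y ⊖ a) ⊖ b)
      a+b = toℕ b + toℕ a
      viaBase : ∀ z → toℕ ((z ⊖ a) ⊖ b) + a+b ≡ toℕ z mod N
      viaBase z = begin
        toℕ ((z ⊖ a) ⊖ b) + (toℕ b + toℕ a)  ≡⟨ +-assoc _ (toℕ b) (toℕ a) ⟨
        toℕ ((z ⊖ a) ⊖ b) + toℕ b + toℕ a    ≈⟨ +-congʳ-mod (toℕ a) (x⊖y+y≡x (z ⊖ a) b) ⟩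
        toℕ (z ⊖ a) + toℕ a                  ≈⟨ x⊖y+y≡x z a ⟩
        toℕ z                                ∎

mainTheorem10 : (N : ℕ) .{{_ : NonZero N}} (A : Subset N) (b : Fin N) (l : ℕ) →
    3 * l < N →
    2 * ∣ diffSet A ∩ ∁ (interval b l) ∣ < ∣ A ∣ →
    ∃ λ (a : Fin N) → A ⊆ interval a l
mainTheorem10 N A b l 3l<N few = differencesWithin⇒⊆interval 3l<N
  (CommonBases.differencesWithin {b = b} few) (0<∣p∣⇒Nonempty (≤-<-trans z≤n few))
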